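{- Let $\mathbf x=\{x_1,\dots,x_n\}$ be indeterminates, $q$ an indeterminate and $k\in\mathbb Z$. For $r\in\mathbb Z$ let $p_r(\mathbf x)=x_1^r+\dots+x_n^r$ (so $p_0=n$). Let $\mathfrak{Pf}(\mathbf q,\mathbf p(\mathbf x),k)$ be the Pfaffian of the antisymmetric $2n\times2n$ matrix with $(i,j)$ entry $(q^{i-1}-q^{j-1})\,p_{i+j-3+k}(\mathbf x)$. Then $$\mathfrak{Pf}(\mathbf q,\mathbf p(\mathbf x),k)=(-q)^{\binom n2}(1-q)^n(x_1\cdots x_n)^k\,\Delta(\mathbf x)^2\,\mathcal D(\mathbf x,q),$$ where $\Delta(\mathbf x)=\prod_{1\le i<j\le n}(x_i-x_j)$ and $\mathcal D(\mathbf x,q)=\prod_{1\le i<j\le n}(x_i-qx_j)(x_j-qx_i)$.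
   Context: Pfaffians use the standard normalization ($\mathrm{Pf}^2=\det$), and computations take place in the field of rational functions in $x_1,\dots,x_n,q$. The paper writes the factor $\Delta(\mathbf x)^2$ as $\mathcal D(\mathbf x,1)$, defined as the square of the Vandermonde determinant. -}

module Defs where

open import Level using (Level)
open import Algebra.Bundles using (CommutativeRing)
open import Data.Nat as ℕ using (ℕ; zero; suc; _∸_; _<ᵇ_)
open import Data.Integer as ℤ using (ℤ; +_; -[1+_])
open import Data.Fin using (Fin; toℕ)
open import Data.Vec using (Vec; []; _∷_; lookup; removeAt; tabulate)
open import Data.Bool using (if_then_else_)

module _ {c ℓ : Level} (R : CommutativeRing c ℓ) where
  open CommutativeRing R

  pow : Carrier → ℕ → Carrier
  pow a zero = 1#
  pow a (suc m) = a * pow a m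

  -- integer power of an invertible element a with given inverse b
  powℤ : Carrier → Carrier → ℤ → Carrier
  powℤ a b (+ m) = pow a m
  powℤ a b -[1+ m ] = pow b (suc m)

  sumFin : (m : ℕ) → (Fin m → Carrier) → Carrier
  sumFin zero f = 0#
  sumFin (suc m) f = f Fin.zero + sumFin m (λ i → f (Fin.suc i))
    where import Data.Fin as Fin

  prodFin : (m : ℕ) → (Fin m → Carrier) → Carrier
  prodFin zero f = 1#
  prodFin (suc m) f = f Fin.zero * prodFin m (λ i → f (Fin.suc i))
    where import Data.Fin as Fin

  prodPairs : (m : ℕ) → (Fin m → Fin m → Carrier) → Carrier
  prodPairs m f = prodFin m (λ i → prodFin m (λ j →
    if toℕ i <ᵇ toℕ j then f i j else 1#))

  alt : ℕ → Carrier → Carrier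
  alt zero t = t
  alt (suc p) t = - alt p t

  -- Pfaffian of the principal submatrix of a : ℕ → ℕ → Carrier on the
  -- index list v (length m), by expansion along the first index:
  -- Pf = Σ_p (-1)^p a(i, j_p) Pf(remaining), standard normalisation Pf² = det.
  pfAux : (a : ℕ → ℕ → Carrier) (m : ℕ) → Vec ℕ m → Carrier
  pfAux a zero [] = 1#
  pfAux a (suc zero) _ = 0#
  pfAux a (suc (suc m)) (i ∷ rest) =
    sumFin (suc m) (λ p → alt (toℕ p) (a i (lookup rest p) * pfAux a m (removeAt rest p)))

  -- Pfaffian of the 2m × 2m matrix with (1-based) entries a i j
  Pf : (m : ℕ) → (ℕ → ℕ → Carrier) → Carrier
  Pf m a = pfAux a (2 ℕ.* m) (tabulate (λ i → suc (toℕ i)))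

  -- power sums p_r(x) = Σ x_i^r, r ∈ ℤ (y i is the inverse of x i)
  powerSum : (n : ℕ) → (Fin n → Carrier) → (Fin n → Carrier) → ℤ → Carrier
  powerSum n x y r = sumFin n (λ i → powℤ (x i) (y i) r)

  pfMatrix : (n : ℕ) → (Fin n → Carrier) → (Fin n → Carrier) → Carrier → ℤ → ℕ → ℕ → Carrier
  pfMatrix n x y q k i j =
    (pow q (i ∸ 1) - pow q (j ∸ 1)) * powerSum n x y (((+ (i ℕ.+ j)) ℤ.- + 3) ℤ.+ k)

  PfQ : (n : ℕ) → (Fin n → Carrier) → (Fin n → Carrier) → Carrier → ℤ → Carrier
  PfQ n x y q k = Pf n (pfMatrix n x y q k)

  vandermonde : (n : ℕ) → (Fin n → Carrier) → Carrier
  vandermonde n x = prodPairs n (λ i j → x i - x j)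

  Dq : (n : ℕ) → (Fin n → Carrier) → Carrier → Carrier
  Dq n x q = prodPairs n (λ i j → (x i - q * x j) * (x j - q * x i))

module Submission where

-- With w_l = x_l^(k-1), the entry (q^(i-1) - q^(j-1)) p_(i+j-3+k)(x) is B(z^(i-1), z^(j-1)) for the form
--   B(r, s) = Σ_l w_l (r(q x_l) s(x_l) - r(x_l) s(q x_l))
-- on functions r, s, a sum of n alternating forms of rank two.  The Pfaffian is alternating and
-- multilinear in its rows, so the rows 1, z, z², … may be replaced by 1, z - x₁, (z - x₁)(z - q x₁) z^i.
-- All rows after the second vanish at x₁ and q x₁, so the first summand of B is only seen by the
-- entry of the first two rows, which is w₁ (x₁ - q x₁).  This splits the Pfaffian into that entry
-- times the Pfaffian of the remaining n - 1 summands, reweighted by the values of (z - x₁)(z - q x₁)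
-- at x_j and q x_j, plus a Pfaffian of size 2n for n - 1 rank-two summands, which vanishes.
-- Induction on n gives Π_l w_l (x_l - q x_l) times Π_{l<m} of the four factors
-- (x_m - x_l)(x_m - q x_l)(q x_m - x_l)(q x_m - q x_l), which rearranges to the stated product.

open import Defs
open import Level using (Level; _⊔_)
open import Algebra.Bundles using (CommutativeRing)
open import Data.Nat as ℕ using (ℕ; zero; suc)
open import Data.Integer as ℤ using (ℤ; +_; -[1+_])
open import Data.Fin as Fin using (Fin; toℕ)
open import Data.Nat.Combinatorics using (_C_)
open import Data.Maybe using (Maybe; just; nothing)
open import Data.Vec using (Vec; []; _∷_; lookup; removeAt; map; tabulate)
open import Data.Vec.Relation.Unary.All using (All; []; _∷_)
open import Data.Vec.Relation.Unary.All.Properties using (lookup⁺)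
open import Data.Vec.Relation.Binary.Pointwise.Inductive as Pointwise using (Pointwise; []; _∷_)
open import Data.Vec.Functional using (head; tail)
open import Data.Vec.Properties using (lookup-map; tabulate-∘)
open import Data.Sign as Sign using (Sign)
open import Relation.Nullary using (yes; no)
open import Relation.Binary.PropositionalEquality as ≡ using (_≡_)
import Data.Integer.Properties as ℤ
import Data.Nat.Properties as ℕ
import Algebra.Solver.Ring as RingSolver
import Algebra.Solver.Ring.AlmostCommutativeRing as AlmostCommutativeRing

removeAt-map : ∀ {a b} {A : Set a} {B : Set b} (f : A → B) {n} (xs : Vec A (suc n)) i →
               removeAt (map f xs) i ≡ map f (removeAt xs i)
removeAt-map f (x ∷ xs) Fin.zero = ≡.refl
removeAt-map f (x ∷ y ∷ xs) (Fin.suc i) = ≡.cong (f x ∷_) (removeAt-map f (y ∷ xs) i)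

All-removeAt : ∀ {a p} {A : Set a} {P : A → Set p} {n} {xs : Vec A (suc n)} → All P xs → ∀ i → All P (removeAt xs i)
All-removeAt (px ∷ pxs) Fin.zero = pxs
All-removeAt {xs = _ ∷ _ ∷ _} (px ∷ pxs) (Fin.suc i) = px ∷ All-removeAt pxs i

-- The standard library's ring solver normalises with coefficients in a ring mapped into R; ℤ maps
-- into every commutative ring.
module IntegerCoefficientSolver {c ℓ : Level} (R : CommutativeRing c ℓ) where
  open CommutativeRing R
  open import Algebra.Properties.Ring ring using (-‿distribˡ-*; -‿involutive; -‿+-comm; -0#≈0#)
  open import Algebra.Properties.Semiring.Mult semiring using (_×_; ×-homo-+; ×1-homo-*)
  open import Relation.Binary.Reasoning.Setoid setoid

  fromℤ : ℤ → Carrier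
  fromℤ (+ n) = n × 1#
  fromℤ -[1+ n ] = - (suc n × 1#)

  fromℤ-⊖ : ∀ m n → fromℤ (m ℤ.⊖ n) ≈ m × 1# - n × 1#
  fromℤ-⊖ zero zero = sym (-‿inverseʳ 0#)
  fromℤ-⊖ zero (suc n) = sym (+-identityˡ _)
  fromℤ-⊖ (suc m) zero = sym (trans (+-congˡ -0#≈0#) (+-identityʳ _))
  fromℤ-⊖ (suc m) (suc n) = begin
    fromℤ (suc m ℤ.⊖ suc n)        ≡⟨ ≡.cong fromℤ (ℤ.[1+m]⊖[1+n]≡m⊖n m n) ⟩
    fromℤ (m ℤ.⊖ n)                ≈⟨ fromℤ-⊖ m n ⟩
    a - b                          ≈⟨ sym (+-identityˡ _) ⟩
    0# + (a - b)                   ≈⟨ +-congʳ (sym (-‿inverseʳ 1#)) ⟩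
    (1# - 1#) + (a - b)            ≈⟨ +-assoc _ _ _ ⟩
    1# + (- 1# + (a - b))          ≈⟨ +-congˡ (sym (+-assoc _ _ _)) ⟩
    1# + ((- 1# + a) - b)          ≈⟨ +-congˡ (+-congʳ (+-comm _ _)) ⟩
    1# + ((a - 1#) - b)            ≈⟨ +-congˡ (+-assoc _ _ _) ⟩
    1# + (a + (- 1# - b))          ≈⟨ sym (+-assoc _ _ _) ⟩
    (1# + a) + (- 1# - b)          ≈⟨ +-congˡ (-‿+-comm 1# b) ⟩
    (1# + a) - (1# + b)            ∎
    where a = m × 1#; b = n × 1#

  fromℤ-neg : ∀ i → fromℤ (ℤ.- i) ≈ - fromℤ i
  fromℤ-neg (+ zero) = sym -0#≈0#
  fromℤ-neg (+ suc n) = refl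
  fromℤ-neg -[1+ n ] = sym (-‿involutive _)

  fromℤ-+ : ∀ i j → fromℤ (i ℤ.+ j) ≈ fromℤ i + fromℤ j
  fromℤ-+ -[1+ m ] -[1+ n ] = begin
    - (1# + (suc m ℕ.+ n) × 1#)          ≈⟨ -‿cong (+-congˡ (×-homo-+ 1# (suc m) n)) ⟩
    - (1# + (suc m × 1# + n × 1#))       ≈⟨ -‿cong (+-congˡ (+-comm _ _)) ⟩
    - (1# + (n × 1# + suc m × 1#))       ≈⟨ -‿cong (sym (+-assoc _ _ _)) ⟩
    - (suc n × 1# + suc m × 1#)          ≈⟨ sym (-‿+-comm _ _) ⟩
    - (suc n × 1#) + - (suc m × 1#)      ≈⟨ +-comm _ _ ⟩
    - (suc m × 1#) + - (suc n × 1#)      ∎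
  fromℤ-+ -[1+ m ] (+ n) = trans (fromℤ-⊖ n (suc m)) (+-comm _ _)
  fromℤ-+ (+ m) -[1+ n ] = fromℤ-⊖ m (suc n)
  fromℤ-+ (+ m) (+ n) = ×-homo-+ 1# m n

  fromSign : Sign → Carrier
  fromSign Sign.+ = 1#
  fromSign Sign.- = - 1#

  fromSign-* : ∀ s t → fromSign (s Sign.* t) ≈ fromSign s * fromSign t
  fromSign-* Sign.+ t = sym (*-identityˡ _)
  fromSign-* Sign.- Sign.+ = sym (*-identityʳ _)
  fromSign-* Sign.- Sign.- = begin
    1#             ≈⟨ sym (-‿involutive _) ⟩
    - - 1#         ≈⟨ -‿cong (sym (*-identityˡ _)) ⟩
    - (1# * - 1#)  ≈⟨ -‿distribˡ-* _ _ ⟩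
    - 1# * - 1#    ∎

  fromℤ-◃ : ∀ s n → fromℤ (s ℤ.◃ n) ≈ fromSign s * n × 1#
  fromℤ-◃ s zero = sym (zeroʳ _)
  fromℤ-◃ Sign.+ (suc n) = sym (*-identityˡ _)
  fromℤ-◃ Sign.- (suc n) = trans (-‿cong (sym (*-identityˡ _))) (-‿distribˡ-* _ _)

  fromℤ-signAbs : ∀ i → fromℤ i ≈ fromSign (ℤ.sign i) * ℤ.∣ i ∣ × 1#
  fromℤ-signAbs i = trans (reflexive (≡.cong fromℤ (≡.sym (ℤ.◃-inverse i)))) (fromℤ-◃ (ℤ.sign i) ℤ.∣ i ∣)

  fromℤ-* : ∀ i j → fromℤ (i ℤ.* j) ≈ fromℤ i * fromℤ j
  fromℤ-* i j = begin
    fromℤ (s Sign.* t ℤ.◃ a ℕ.* b)        ≈⟨ fromℤ-◃ (s Sign.* t) (a ℕ.* b) ⟩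
    fromSign (s Sign.* t) * (a ℕ.* b) × 1# ≈⟨ *-cong (fromSign-* s t) (×1-homo-* a b) ⟩
    (fromSign s * fromSign t) * (a × 1# * b × 1#) ≈⟨ interchange ⟩
    (fromSign s * a × 1#) * (fromSign t * b × 1#) ≈⟨ sym (*-cong (fromℤ-signAbs i) (fromℤ-signAbs j)) ⟩
    fromℤ i * fromℤ j                     ∎
    where
    s = ℤ.sign i; t = ℤ.sign j; a = ℤ.∣ i ∣; b = ℤ.∣ j ∣
    interchange : ∀ {w x y z} → (w * x) * (y * z) ≈ (w * y) * (x * z)
    interchange {w} {x} {y} {z} = begin
      (w * x) * (y * z)  ≈⟨ *-assoc _ _ _ ⟩
      w * (x * (y * z))  ≈⟨ *-congˡ (sym (*-assoc _ _ _)) ⟩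
      w * ((x * y) * z)  ≈⟨ *-congˡ (*-congʳ (*-comm _ _)) ⟩
      w * ((y * x) * z)  ≈⟨ *-congˡ (*-assoc _ _ _) ⟩
      w * (y * (x * z))  ≈⟨ sym (*-assoc _ _ _) ⟩
      (w * y) * (x * z)  ∎

  private
    ring⁺ : AlmostCommutativeRing.AlmostCommutativeRing c ℓ
    ring⁺ = AlmostCommutativeRing.fromCommutativeRing R

    fromℤ-homomorphism : ℤ.+-*-rawRing AlmostCommutativeRing.-Raw-AlmostCommutative⟶ ring⁺
    fromℤ-homomorphism = record
      { ⟦_⟧ = fromℤ ; +-homo = fromℤ-+ ; *-homo = fromℤ-* ; -‿homo = fromℤ-neg
      ; 0-homo = refl ; 1-homo = +-identityʳ _ }

    fromℤ-≟ : ∀ i j → Maybe (fromℤ i ≈ fromℤ j)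
    fromℤ-≟ i j with i ℤ.≟ j
    ... | yes ≡.refl = just refl
    ... | no _ = nothing

  open RingSolver ℤ.+-*-rawRing ring⁺ fromℤ-homomorphism fromℤ-≟ public
    using (solve; _:=_; _:+_; _:*_; _:-_; :-_; con)

module RingLemmas {c ℓ : Level} (R : CommutativeRing c ℓ) where
  open CommutativeRing R
  open IntegerCoefficientSolver R
  open import Relation.Binary.Reasoning.Setoid setoid

  sumFin-cong : ∀ m {f h : Fin m → Carrier} → (∀ i → f i ≈ h i) → sumFin R m f ≈ sumFin R m h
  sumFin-cong zero e = refl
  sumFin-cong (suc m) e = +-cong (e Fin.zero) (sumFin-cong m (λ i → e (Fin.suc i)))

  sumFin-zero : ∀ m {f : Fin m → Carrier} → (∀ i → f i ≈ 0#) → sumFin R m f ≈ 0#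
  sumFin-zero zero e = refl
  sumFin-zero (suc m) e = trans (+-cong (e Fin.zero) (sumFin-zero m (λ i → e (Fin.suc i)))) (+-identityʳ _)

  sumFin-neg : ∀ m (f : Fin m → Carrier) → sumFin R m (λ i → - f i) ≈ - sumFin R m f
  sumFin-neg zero f = solve 0 (con (+ 0) := :- con (+ 0)) refl
  sumFin-neg (suc m) f = trans (+-congˡ (sumFin-neg m _)) (solve 2 (λ a b → (:- a) :+ (:- b) := :- (a :+ b)) refl _ _)

  sumFin-*ˡ : ∀ m a (f : Fin m → Carrier) → sumFin R m (λ i → a * f i) ≈ a * sumFin R m f
  sumFin-*ˡ zero a f = sym (zeroʳ _)
  sumFin-*ˡ (suc m) a f = trans (+-congˡ (sumFin-*ˡ m a _)) (sym (distribˡ _ _ _))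

  sumFin-affine : ∀ m κ {f g h : Fin m → Carrier} → (∀ i → f i ≈ g i + κ * h i) →
                  sumFin R m f ≈ sumFin R m g + κ * sumFin R m h
  sumFin-affine zero κ e = solve 1 (λ κ → con (+ 0) := con (+ 0) :+ κ :* con (+ 0)) refl κ
  sumFin-affine (suc m) κ e = trans (+-cong (e Fin.zero) (sumFin-affine m κ (λ i → e (Fin.suc i))))
    (solve 5 (λ κ g h G H → (g :+ κ :* h) :+ (G :+ κ :* H) := (g :+ G) :+ κ :* (h :+ H)) refl κ _ _ _ _)

  alt-cong : ∀ p {x y} → x ≈ y → alt R p x ≈ alt R p y
  alt-cong zero e = e
  alt-cong (suc p) e = -‿cong (alt-cong p e)

  alt-zero : ∀ p {x} → x ≈ 0# → alt R p x ≈ 0#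
  alt-zero zero e = e
  alt-zero (suc p) e = trans (-‿cong (alt-zero p e)) (solve 0 (:- con (+ 0) := con (+ 0)) refl)

  alt-neg : ∀ p x → alt R p (- x) ≈ - alt R p x
  alt-neg zero x = refl
  alt-neg (suc p) x = -‿cong (alt-neg p x)

  alt-affine : ∀ p κ x y → alt R p (x + κ * y) ≈ alt R p x + κ * alt R p y
  alt-affine zero κ x y = refl
  alt-affine (suc p) κ x y = trans (-‿cong (alt-affine p κ x y))
    (solve 3 (λ κ a b → :- (a :+ κ :* b) := (:- a) :+ κ :* (:- b)) refl κ _ _)

  prodFin-cong : ∀ m {f h : Fin m → Carrier} → (∀ i → f i ≈ h i) → prodFin R m f ≈ prodFin R m h
  prodFin-cong zero e = refl
  prodFin-cong (suc m) e = *-cong (e Fin.zero) (prodFin-cong m (λ i → e (Fin.suc i)))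

  prodFin-* : ∀ m (f h : Fin m → Carrier) → prodFin R m (λ i → f i * h i) ≈ prodFin R m f * prodFin R m h
  prodFin-* zero f h = sym (*-identityʳ _)
  prodFin-* (suc m) f h = trans (*-congˡ (prodFin-* m _ _))
    (solve 4 (λ a b c d → (a :* b) :* (c :* d) := (a :* c) :* (b :* d)) refl _ _ _ _)

  prodFin-const : ∀ m a → prodFin R m (λ _ → a) ≈ pow R a m
  prodFin-const zero a = refl
  prodFin-const (suc m) a = *-congˡ (prodFin-const m a)

  prodPairs-suc : ∀ m (f : Fin (suc m) → Fin (suc m) → Carrier) →
    prodPairs R (suc m) f ≈
      prodFin R m (λ j → f Fin.zero (Fin.suc j)) * prodPairs R m (λ i j → f (Fin.suc i) (Fin.suc j))
  prodPairs-suc m f = *-cong (*-identityˡ _) (prodFin-cong m (λ i → *-identityˡ _))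

  pow-+ : ∀ a m n → pow R a (m ℕ.+ n) ≈ pow R a m * pow R a n
  pow-+ a zero n = sym (*-identityˡ _)
  pow-+ a (suc m) n = trans (*-congˡ (pow-+ a m n)) (sym (*-assoc _ _ _))

  pow-* : ∀ a b m → pow R (a * b) m ≈ pow R a m * pow R b m
  pow-* a b zero = sym (*-identityˡ _)
  pow-* a b (suc m) = trans (*-congˡ (pow-* a b m))
    (solve 4 (λ a b p q → (a :* b) :* (p :* q) := (a :* p) :* (b :* q)) refl a b _ _)

  module _ {x y : Carrier} (xy≈1 : x * y ≈ 1#) where

    powℤ-suc : ∀ e → powℤ R x y (e ℤ.+ + 1) ≈ powℤ R x y e * x
    powℤ-suc (+ m) = trans (pow-+ x m 1) (*-congˡ (*-identityʳ x))
    powℤ-suc -[1+ zero ] = sym (trans (*-congʳ (*-identityʳ y)) (trans (*-comm y x) xy≈1))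
    powℤ-suc -[1+ suc m ] = sym (begin
      (y * pow R y (suc m)) * x ≈⟨ solve 3 (λ y p x → (y :* p) :* x := (x :* y) :* p) refl y (pow R y (suc m)) x ⟩
      (x * y) * pow R y (suc m) ≈⟨ trans (*-congʳ xy≈1) (*-identityˡ _) ⟩
      pow R y (suc m)           ∎)

    powℤ-pred : ∀ e → powℤ R x y (e ℤ.+ -[1+ 0 ]) ≈ powℤ R x y e * y
    powℤ-pred (+ zero) = trans (*-identityʳ y) (sym (*-identityˡ y))
    powℤ-pred (+ suc m) = sym (begin
      (x * pow R x m) * y ≈⟨ solve 3 (λ x p y → (x :* p) :* y := (x :* y) :* p) refl x (pow R x m) y ⟩
      (x * y) * pow R x m ≈⟨ trans (*-congʳ xy≈1) (*-identityˡ _) ⟩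
      pow R x m           ∎)
    powℤ-pred -[1+ m ] = trans (reflexive (≡.cong (λ t → pow R y (suc (suc t))) (ℕ.+-identityʳ m)))
      (solve 2 (λ y p → y :* (y :* p) := (y :* p) :* y) refl y (pow R y m))

    powℤ-+ℕ : ∀ e m → powℤ R x y (e ℤ.+ + m) ≈ powℤ R x y e * pow R x m
    powℤ-+ℕ e zero = trans (reflexive (≡.cong (powℤ R x y) (ℤ.+-identityʳ e))) (sym (*-identityʳ _))
    powℤ-+ℕ e (suc m) = begin
      powℤ R x y (e ℤ.+ + suc m)         ≡⟨ ≡.cong (powℤ R x y) regroup ⟩
      powℤ R x y ((e ℤ.+ + m) ℤ.+ + 1)   ≈⟨ powℤ-suc (e ℤ.+ + m) ⟩
      powℤ R x y (e ℤ.+ + m) * x         ≈⟨ *-congʳ (powℤ-+ℕ e m) ⟩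
      (powℤ R x y e * pow R x m) * x     ≈⟨ solve 3 (λ a b x → (a :* b) :* x := a :* (x :* b)) refl (powℤ R x y e) (pow R x m) x ⟩
      powℤ R x y e * pow R x (suc m)     ∎
      where
      regroup : e ℤ.+ + suc m ≡ (e ℤ.+ + m) ℤ.+ + 1
      regroup = ≡.trans (≡.cong (λ t → e ℤ.+ + t) (ℕ.+-comm 1 m)) (≡.sym (ℤ.+-assoc e (+ m) (+ 1)))

module GeneralPfaffian {c ℓ : Level} (R : CommutativeRing c ℓ) where
  open import Data.Product using (_×_; _,_)
  open CommutativeRing R
  open IntegerCoefficientSolver R
  open RingLemmas R
  open import Relation.Binary.Reasoning.Setoid setoid

  module _ {a : Level} {A : Set a} (g : A → A → Carrier) where

    -- Expansion along a new first row u with minors computed by an arbitrary G: multilinearity and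
    -- alternation are proved by induction over such G, with pfaffian m as the final instance.
    expansion : (m : ℕ) → (Vec A m → Carrier) → A → Vec A (suc m) → Carrier
    expansion m G u r = sumFin R (suc m) (λ p → alt R (toℕ p) (g u (lookup r p) * G (removeAt r p)))

    pfaffian : (m : ℕ) → Vec A m → Carrier
    pfaffian zero _ = 1#
    pfaffian (suc zero) _ = 0#
    pfaffian (suc (suc m)) (u ∷ r) = expansion m (pfaffian m) u r

    expansion-single : ∀ G u d → expansion 0 G u (d ∷ []) ≈ g u d * G []
    expansion-single G u d = +-identityʳ _

    expansion-cons : ∀ m G u d r →
      expansion (suc m) G u (d ∷ r) ≈ g u d * G r - expansion m (λ Y → G (d ∷ Y)) u r
    expansion-cons m G u d (e ∷ r) = +-congˡ (sumFin-neg (suc m)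
      (λ p → alt R (toℕ p) (g u (lookup (e ∷ r) p) * G (d ∷ removeAt (e ∷ r) p))))

    expansion-cong : ∀ m {G H : Vec A m → Carrier} u r → (∀ Y → G Y ≈ H Y) →
                     expansion m G u r ≈ expansion m H u r
    expansion-cong m u r e =
      sumFin-cong (suc m) (λ p → alt-cong (toℕ p) (*-congˡ {g u (lookup r p)} (e (removeAt r p))))

    expansion-zero : ∀ m {G : Vec A m → Carrier} u r → (∀ Y → G Y ≈ 0#) → expansion m G u r ≈ 0#
    expansion-zero m u r e =
      sumFin-zero (suc m) (λ p → alt-zero (toℕ p) (trans (*-congˡ (e (removeAt r p))) (zeroʳ (g u (lookup r p)))))

    expansion-neg : ∀ m (G : Vec A m → Carrier) u r → expansion m (λ Y → - G Y) u r ≈ - expansion m G u r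
    expansion-neg m G u r = trans
      (sumFin-cong (suc m) (λ p → trans (alt-cong (toℕ p) (solve 2 (λ a b → a :* (:- b) := :- (a :* b)) refl (g u (lookup r p)) (G (removeAt r p))))
                                        (alt-neg (toℕ p) _)))
      (sumFin-neg (suc m) (λ p → alt R (toℕ p) (g u (lookup r p) * G (removeAt r p))))

    expansion-affine : ∀ m κ (G H : Vec A m → Carrier) u r →
      expansion m (λ Y → G Y + κ * H Y) u r ≈ expansion m G u r + κ * expansion m H u r
    expansion-affine m κ G H u r = sumFin-affine (suc m) κ (λ p → trans
      (alt-cong (toℕ p) (solve 4 (λ κ a b c → a :* (b :+ κ :* c) := a :* b :+ κ :* (a :* c)) refl
        κ (g u (lookup r p)) (G (removeAt r p)) (H (removeAt r p))))
      (alt-affine (toℕ p) κ _ _))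

    expansion-affine-row : ∀ m (G : Vec A m → Carrier) κ x w v r → (∀ z → g x z ≈ g w z + κ * g v z) →
      expansion m G x r ≈ expansion m G w r + κ * expansion m G v r
    expansion-affine-row m G κ x w v r e = sumFin-affine (suc m) κ (λ p → trans
      (alt-cong (toℕ p) (trans (*-congʳ (e (lookup r p)))
        (solve 4 (λ κ a b c → (b :+ κ :* c) :* a := b :* a :+ κ :* (c :* a)) refl
          κ (G (removeAt r p)) (g w (lookup r p)) (g v (lookup r p)))))
      (alt-affine (toℕ p) κ _ _))

    -- Expanding twice along the same row u produces every term twice, with opposite signs.
    expansion-twice : ∀ m G u r → expansion (suc m) (expansion m G u) u r ≈ 0#
    expansion-twice zero G u (d ∷ e ∷ []) = begin
      expansion 1 (expansion 0 G u) u (d ∷ e ∷ [])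
        ≈⟨ expansion-cons 0 (expansion 0 G u) u d (e ∷ []) ⟩
      g u d * expansion 0 G u (e ∷ []) - expansion 0 (λ Y → expansion 0 G u (d ∷ Y)) u (e ∷ [])
        ≈⟨ +-cong (*-congˡ (expansion-single G u e))
                  (-‿cong (trans (expansion-single (λ Y → expansion 0 G u (d ∷ Y)) u e) (*-congˡ (expansion-single G u d)))) ⟩
      g u d * (g u e * G []) - g u e * (g u d * G [])
        ≈⟨ solve 3 (λ a b c → a :* (b :* c) :- b :* (a :* c) := con (+ 0)) refl (g u d) (g u e) (G []) ⟩
      0# ∎
    expansion-twice (suc m) G u (d ∷ r) = begin
      expansion (suc (suc m)) (expansion (suc m) G u) u (d ∷ r)
        ≈⟨ expansion-cons (suc m) (expansion (suc m) G u) u d r ⟩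
      g u d * X - expansion (suc m) (λ Y → expansion (suc m) G u (d ∷ Y)) u r
        ≈⟨ +-congˡ (-‿cong (expansion-cong (suc m) u r (λ Y → trans (expansion-cons m G u d Y) (+-comm _ _)))) ⟩
      g u d * X - expansion (suc m) (λ Y → - H Y + g u d * G Y) u r
        ≈⟨ +-congˡ (-‿cong (expansion-affine (suc m) (g u d) (λ Y → - H Y) G u r)) ⟩
      g u d * X - (expansion (suc m) (λ Y → - H Y) u r + g u d * X)
        ≈⟨ +-congˡ (-‿cong (+-congʳ (trans (expansion-neg (suc m) H u r) (-‿cong (expansion-twice m (λ Z → G (d ∷ Z)) u r))))) ⟩
      g u d * X - (- 0# + g u d * X)
        ≈⟨ solve 1 (λ a → a :- (:- con (+ 0) :+ a) := con (+ 0)) refl (g u d * X) ⟩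
      0# ∎
      where
      X = expansion (suc m) G u r
      H = expansion m (λ Z → G (d ∷ Z)) u

    data RepeatsAdjacent : ∀ {m} → Vec A m → Set a where
      here  : ∀ {m} u (r : Vec A m) → RepeatsAdjacent (u ∷ u ∷ r)
      there : ∀ {m} d {r : Vec A m} → RepeatsAdjacent r → RepeatsAdjacent (d ∷ r)

    expansion-repeated : ∀ m (G : Vec A m → Carrier) → (∀ r → RepeatsAdjacent r → G r ≈ 0#) →
                         ∀ u r → RepeatsAdjacent r → expansion m G u r ≈ 0#
    expansion-repeated zero G hG u (d ∷ []) (there d ())
    expansion-repeated (suc zero) G hG u (w ∷ w ∷ []) (here w []) = begin
      expansion 1 G u (w ∷ w ∷ [])
        ≈⟨ expansion-cons 0 G u w (w ∷ []) ⟩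
      g u w * G (w ∷ []) - expansion 0 (λ Y → G (w ∷ Y)) u (w ∷ [])
        ≈⟨ +-congˡ (-‿cong (expansion-single (λ Y → G (w ∷ Y)) u w)) ⟩
      g u w * G (w ∷ []) - g u w * G (w ∷ [])
        ≈⟨ -‿inverseʳ _ ⟩
      0# ∎
    expansion-repeated (suc (suc m)) G hG u (w ∷ w ∷ r) (here w r) = begin
      expansion (suc (suc m)) G u (w ∷ w ∷ r)
        ≈⟨ expansion-cons (suc m) G u w (w ∷ r) ⟩
      g u w * G (w ∷ r) - expansion (suc m) (λ Y → G (w ∷ Y)) u (w ∷ r)
        ≈⟨ +-congˡ (-‿cong (expansion-cons m (λ Y → G (w ∷ Y)) u w r)) ⟩
      g u w * G (w ∷ r) - (g u w * G (w ∷ r) - expansion m (λ Y → G (w ∷ w ∷ Y)) u r)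
        ≈⟨ +-congˡ (-‿cong (+-congˡ (-‿cong (expansion-zero m u r (λ Y → hG (w ∷ w ∷ Y) (here w Y)))))) ⟩
      g u w * G (w ∷ r) - (g u w * G (w ∷ r) - 0#)
        ≈⟨ solve 1 (λ a → a :- (a :- con (+ 0)) := con (+ 0)) refl (g u w * G (w ∷ r)) ⟩
      0# ∎
    expansion-repeated (suc m) G hG u (d ∷ r) (there d rep) = begin
      expansion (suc m) G u (d ∷ r)
        ≈⟨ expansion-cons m G u d r ⟩
      g u d * G r - expansion m (λ Y → G (d ∷ Y)) u r
        ≈⟨ +-cong (trans (*-congˡ (hG r rep)) (zeroʳ _))
                  (-‿cong (expansion-repeated m (λ Y → G (d ∷ Y)) (λ Y rep′ → hG (d ∷ Y) (there d rep′)) u r rep)) ⟩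
      0# - 0#
        ≈⟨ -‿inverseʳ _ ⟩
      0# ∎

    module _ (g-alternating : ∀ x → g x x ≈ 0#) where

      pfaffian-repeated : ∀ m r → RepeatsAdjacent r → pfaffian m r ≈ 0#
      pfaffian-repeated (suc zero) r rep = refl
      pfaffian-repeated (suc (suc zero)) (u ∷ u ∷ []) (here u []) =
        trans (+-identityʳ _) (trans (*-identityʳ _) (g-alternating u))
      pfaffian-repeated (suc (suc (suc zero))) (u ∷ u ∷ r) (here u r) = begin
        expansion 1 (pfaffian 1) u (u ∷ r)
          ≈⟨ expansion-cons 0 (pfaffian 1) u u r ⟩
        g u u * 0# - expansion 0 (λ Y → 0#) u r
          ≈⟨ +-cong (zeroʳ _) (-‿cong (expansion-zero 0 u r (λ Y → refl))) ⟩
        0# - 0#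
          ≈⟨ -‿inverseʳ _ ⟩
        0# ∎
      pfaffian-repeated (suc (suc (suc (suc m)))) (u ∷ u ∷ r) (here u r) = begin
        expansion (suc (suc m)) (pfaffian (suc (suc m))) u (u ∷ r)
          ≈⟨ expansion-cons (suc m) (pfaffian (suc (suc m))) u u r ⟩
        g u u * pfaffian (suc (suc m)) r - expansion (suc m) (expansion m (pfaffian m) u) u r
          ≈⟨ +-cong (trans (*-congʳ (g-alternating u)) (zeroˡ _)) (-‿cong (expansion-twice m (pfaffian m) u r)) ⟩
        0# - 0#
          ≈⟨ -‿inverseʳ _ ⟩
        0# ∎
      pfaffian-repeated (suc (suc m)) (d ∷ r) (there d rep) =
        expansion-repeated m (pfaffian m) (pfaffian-repeated m) d r rep

    data AffineInOneRow (κ : Carrier) : ∀ {m} → Vec A m → Vec A m → Vec A m → Set (a ⊔ ℓ) where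
      here  : ∀ {m x w v} (r : Vec A m) →
              (∀ z → g x z ≈ g w z + κ * g v z) → (∀ z → g z x ≈ g z w + κ * g z v) →
              AffineInOneRow κ (x ∷ r) (w ∷ r) (v ∷ r)
      there : ∀ {m} d {r s t : Vec A m} → AffineInOneRow κ r s t → AffineInOneRow κ (d ∷ r) (d ∷ s) (d ∷ t)

    Multilinear : ∀ {m} → (Vec A m → Carrier) → Set (a ⊔ c ⊔ ℓ)
    Multilinear G = ∀ κ {r s t} → AffineInOneRow κ r s t → G r ≈ G s + κ * G t

    multilinear-∷ : ∀ {m} {G : Vec A (suc m) → Carrier} → Multilinear G → ∀ d → Multilinear (λ Y → G (d ∷ Y))
    multilinear-∷ hG d κ l = hG κ (there d l)

    expansion-multilinear : ∀ m {G : Vec A m → Carrier} → Multilinear G → ∀ u → Multilinear (expansion m G u)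
    expansion-multilinear zero {G} hG u κ {x ∷ []} {w ∷ []} {v ∷ []} (here [] e₁ e₂) = begin
      expansion 0 G u (x ∷ [])
        ≈⟨ trans (expansion-single G u x) (*-congʳ (e₂ u)) ⟩
      (g u w + κ * g u v) * G []
        ≈⟨ solve 4 (λ κ a b c → (a :+ κ :* b) :* c := a :* c :+ κ :* (b :* c)) refl κ (g u w) (g u v) (G []) ⟩
      g u w * G [] + κ * (g u v * G [])
        ≈⟨ sym (+-cong (expansion-single G u w) (*-congˡ (expansion-single G u v))) ⟩
      expansion 0 G u (w ∷ []) + κ * expansion 0 G u (v ∷ []) ∎
    expansion-multilinear (suc m) {G} hG u κ {x ∷ r} {w ∷ _} {v ∷ _} (here _ e₁ e₂) = begin
      expansion (suc m) G u (x ∷ r)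
        ≈⟨ expansion-cons m G u x r ⟩
      g u x * G r - expansion m (λ Y → G (x ∷ Y)) u r
        ≈⟨ +-cong (*-congʳ (e₂ u)) (-‿cong (trans (expansion-cong m u r (λ Y → hG κ (here Y e₁ e₂)))
                                                  (expansion-affine m κ (λ Y → G (w ∷ Y)) (λ Y → G (v ∷ Y)) u r))) ⟩
      (g u w + κ * g u v) * G r - (Ew + κ * Ev)
        ≈⟨ solve 6 (λ κ a b c p q → (a :+ κ :* b) :* c :- (p :+ κ :* q) := (a :* c :- p) :+ κ :* (b :* c :- q))
                   refl κ (g u w) (g u v) (G r) Ew Ev ⟩
      (g u w * G r - Ew) + κ * (g u v * G r - Ev)
        ≈⟨ sym (+-cong (expansion-cons m G u w r) (*-congˡ (expansion-cons m G u v r))) ⟩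
      expansion (suc m) G u (w ∷ r) + κ * expansion (suc m) G u (v ∷ r) ∎
      where
      Ew = expansion m (λ Y → G (w ∷ Y)) u r
      Ev = expansion m (λ Y → G (v ∷ Y)) u r
    expansion-multilinear (suc m) {G} hG u κ {d ∷ r} {d ∷ s} {d ∷ t} (there d l) = begin
      expansion (suc m) G u (d ∷ r)
        ≈⟨ expansion-cons m G u d r ⟩
      g u d * G r - expansion m (λ Y → G (d ∷ Y)) u r
        ≈⟨ +-cong (*-congˡ (hG κ l)) (-‿cong (expansion-multilinear m (multilinear-∷ hG d) u κ l)) ⟩
      g u d * (G s + κ * G t) - (Es + κ * Et)
        ≈⟨ solve 6 (λ κ a p q x y → a :* (p :+ κ :* q) :- (x :+ κ :* y) := (a :* p :- x) :+ κ :* (a :* q :- y))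
                   refl κ (g u d) (G s) (G t) Es Et ⟩
      (g u d * G s - Es) + κ * (g u d * G t - Et)
        ≈⟨ sym (+-cong (expansion-cons m G u d s) (*-congˡ (expansion-cons m G u d t))) ⟩
      expansion (suc m) G u (d ∷ s) + κ * expansion (suc m) G u (d ∷ t) ∎
      where
      Es = expansion m (λ Y → G (d ∷ Y)) u s
      Et = expansion m (λ Y → G (d ∷ Y)) u t

    pfaffian-multilinear : ∀ m → Multilinear (pfaffian m)
    pfaffian-multilinear (suc zero) κ l = solve 1 (λ κ → con (+ 0) := con (+ 0) :+ κ :* con (+ 0)) refl κ
    pfaffian-multilinear (suc (suc m)) κ (here r e₁ e₂) = expansion-affine-row m (pfaffian m) κ _ _ _ r e₁
    pfaffian-multilinear (suc (suc m)) κ (there d l) = expansion-multilinear m (pfaffian-multilinear m) d κ l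

    AlternatingMultilinear : ∀ {m} → (Vec A m → Carrier) → Set (a ⊔ c ⊔ ℓ)
    AlternatingMultilinear G = Multilinear G × (∀ r → RepeatsAdjacent r → G r ≈ 0#)

    alternatingMultilinear-∷ : ∀ {m} {G : Vec A (suc m) → Carrier} → AlternatingMultilinear G → ∀ d →
                               AlternatingMultilinear (λ Y → G (d ∷ Y))
    alternatingMultilinear-∷ (hG , hA) d = multilinear-∷ hG d , (λ r rep → hA _ (there d rep))

    pfaffian-alternatingMultilinear : (∀ x → g x x ≈ 0#) → ∀ m → AlternatingMultilinear (pfaffian m)
    pfaffian-alternatingMultilinear g-alternating m =
      pfaffian-multilinear m , pfaffian-repeated g-alternating m

    SameForm : A → A → Set (a ⊔ ℓ)
    SameForm x w = (∀ z → g x z ≈ g w z) × (∀ z → g z x ≈ g z w)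

    multilinear-cong : ∀ {m} {G : Vec A m → Carrier} → Multilinear G → ∀ {r s} → Pointwise SameForm r s → G r ≈ G s
    multilinear-cong hG [] = refl
    multilinear-cong {G = G} hG {x ∷ r} {w ∷ s} ((e₁ , e₂) ∷ rs) = begin
      G (x ∷ r)                  ≈⟨ hG 0# (here r (λ z → trans (e₁ z) (sym (+0* _))) (λ z → trans (e₂ z) (sym (+0* _)))) ⟩
      G (w ∷ r) + 0# * G (x ∷ r) ≈⟨ +0* _ ⟩
      G (w ∷ r)                  ≈⟨ multilinear-cong (multilinear-∷ hG w) rs ⟩
      G (w ∷ s)                  ∎
      where
      +0* : ∀ {y} z → y + 0# * z ≈ y
      +0* z = trans (+-congˡ (zeroˡ z)) (+-identityʳ _)

    alternatingMultilinear-addAdjacent : ∀ {m} {G : Vec A (suc (suc m)) → Carrier} → AlternatingMultilinear G →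
      ∀ κ u {w′ w} r → (∀ z → g w′ z ≈ g w z + κ * g u z) → (∀ z → g z w′ ≈ g z w + κ * g z u) →
      G (u ∷ w′ ∷ r) ≈ G (u ∷ w ∷ r)
    alternatingMultilinear-addAdjacent {G = G} (hG , hA) κ u {w′} {w} r e₁ e₂ = begin
      G (u ∷ w′ ∷ r)                  ≈⟨ hG κ (there u (here r e₁ e₂)) ⟩
      G (u ∷ w ∷ r) + κ * G (u ∷ u ∷ r) ≈⟨ +-congˡ (trans (*-congˡ (hA _ (here u r))) (zeroʳ κ)) ⟩
      G (u ∷ w ∷ r) + 0#              ≈⟨ +-identityʳ _ ⟩
      G (u ∷ w ∷ r)                   ∎

  pfaffian-cong : ∀ {a} {A : Set a} {g h : A → A → Carrier} → (∀ x z → g x z ≈ h x z) →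
                  ∀ m r → pfaffian g m r ≈ pfaffian h m r
  pfaffian-cong e zero r = refl
  pfaffian-cong e (suc zero) r = refl
  pfaffian-cong e (suc (suc m)) (u ∷ r) = sumFin-cong (suc m) (λ p → alt-cong (toℕ p)
    (*-cong (e u (lookup r p)) (pfaffian-cong e m (removeAt r p))))

  pfaffian-map : ∀ {a b} {A : Set a} {B : Set b} (g : B → B → Carrier) (f : A → B) m r →
                 pfaffian g m (map f r) ≈ pfaffian (λ x z → g (f x) (f z)) m r
  pfaffian-map g f zero r = refl
  pfaffian-map g f (suc zero) r = refl
  pfaffian-map g f (suc (suc m)) (u ∷ r) = sumFin-cong (suc m) (λ p → alt-cong (toℕ p)
    (*-cong (reflexive (≡.cong (g (f u)) (lookup-map p f r)))
            (trans (reflexive (≡.cong (pfaffian g m) (removeAt-map f r p))) (pfaffian-map g f m (removeAt r p)))))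

  module Splitting {a} {A : Set a} (g g₁ g₂ : A → A → Carrier) (split : ∀ x z → g x z ≈ g₁ x z + g₂ x z) where

    RightRadical : A → Set (a ⊔ ℓ)
    RightRadical t = ∀ u → g₁ u t ≈ 0#

    g≈g₂-radical : ∀ u {t} → RightRadical t → g u t ≈ g₂ u t
    g≈g₂-radical u {t} rad = trans (split u t) (trans (+-congʳ (rad u)) (+-identityˡ _))

    mutual
      pfaffian-radical : ∀ m r → All RightRadical r → pfaffian g m r ≈ pfaffian g₂ m r
      pfaffian-radical zero r _ = refl
      pfaffian-radical (suc m) (u ∷ r) (_ ∷ rad) = pfaffian-radicalTail m u r rad

      pfaffian-radicalTail : ∀ m u r → All RightRadical r → pfaffian g (suc m) (u ∷ r) ≈ pfaffian g₂ (suc m) (u ∷ r)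
      pfaffian-radicalTail zero u r _ = refl
      pfaffian-radicalTail (suc m) u r rad = sumFin-cong (suc m) (λ p → alt-cong (toℕ p)
        (*-cong (g≈g₂-radical u (lookup⁺ rad p)) (pfaffian-radical m (removeAt r p) (All-removeAt rad p))))

    pfaffian-split : ∀ m u v r → All RightRadical r →
      pfaffian g (suc (suc m)) (u ∷ v ∷ r) ≈ g₁ u v * pfaffian g₂ m r + pfaffian g₂ (suc (suc m)) (u ∷ v ∷ r)
    pfaffian-split zero u v [] _ = trans (+-congʳ (*-congʳ (split u v)))
      (solve 3 (λ x y z → (x :+ y) :* z :+ con (+ 0) := x :* z :+ (y :* z :+ con (+ 0))) refl (g₁ u v) (g₂ u v) 1#)
    pfaffian-split (suc m) u v (e ∷ r) rad = trans
      (+-cong (*-cong (split u v) (pfaffian-radical (suc m) (e ∷ r) rad))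
              (sumFin-cong (suc m) (λ p → alt-cong (suc (toℕ p))
                (*-cong (g≈g₂-radical u (lookup⁺ rad p)) (pfaffian-radicalTail m v _ (All-removeAt rad p))))))
      (solve 4 (λ x y z w → (x :+ y) :* z :+ w := x :* z :+ (y :* z :+ w)) refl (g₁ u v) (g₂ u v) _ _)

module MomentPfaffian {c ℓ : Level} (R : CommutativeRing c ℓ) where
  open import Data.Product using (_,_)
  open CommutativeRing R hiding (zero)
  open IntegerCoefficientSolver R
  open RingLemmas R
  open GeneralPfaffian R
  open import Relation.Binary.Reasoning.Setoid setoid

  Fun : Set c
  Fun = Carrier → Carrier

  _≐_ : Fun → Fun → Set (c ⊔ ℓ)
  x ≐ y = ∀ z → x z ≈ y z

  evaluationForm : (n : ℕ) (α β w : Fin n → Carrier) → Fun → Fun → Carrier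
  evaluationForm n α β w r s = sumFin R n (λ l → w l * (r (α l) * s (β l) - r (β l) * s (α l)))

  geometricRows : Fun → (m : ℕ) → Vec Fun m
  geometricRows h zero = []
  geometricRows h (suc m) = h ∷ geometricRows (λ z → h z * z) m

  one : Fun
  one _ = 1#

  module _ (n : ℕ) (α β w : Fin n → Carrier) where
    private
      B = evaluationForm n α β w

    evaluationForm-alternating : ∀ x → B x x ≈ 0#
    evaluationForm-alternating x = sumFin-zero n (λ l →
      solve 3 (λ k a b → k :* (a :* b :- b :* a) := con (+ 0)) refl (w l) (x (α l)) (x (β l)))

    evaluationForm-affineˡ : ∀ κ x u v → (∀ y → x y ≈ u y + κ * v y) → ∀ z → B x z ≈ B u z + κ * B v z
    evaluationForm-affineˡ κ x u v e z = sumFin-affine n κ (λ l →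
      trans (*-congˡ (+-cong (*-congʳ (e (α l))) (-‿cong (*-congʳ (e (β l))))))
        (solve 8 (λ k a b c d p q t → k :* ((a :+ t :* b) :* q :- (c :+ t :* d) :* p)
                                       := k :* (a :* q :- c :* p) :+ t :* (k :* (b :* q :- d :* p)))
               refl (w l) (u (α l)) (v (α l)) (u (β l)) (v (β l)) (z (α l)) (z (β l)) κ))

    evaluationForm-affineʳ : ∀ κ x u v → (∀ y → x y ≈ u y + κ * v y) → ∀ z → B z x ≈ B z u + κ * B z v
    evaluationForm-affineʳ κ x u v e z = sumFin-affine n κ (λ l →
      trans (*-congˡ (+-cong (*-congˡ (e (β l))) (-‿cong (*-congˡ (e (α l))))))
        (solve 8 (λ k a b c d p q t → k :* (p :* (c :+ t :* d) :- q :* (a :+ t :* b))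
                                       := k :* (p :* c :- q :* a) :+ t :* (k :* (p :* d :- q :* b)))
               refl (w l) (u (α l)) (v (α l)) (u (β l)) (v (β l)) (z (α l)) (z (β l)) κ))

    ≐⇒SameForm : ∀ {x y} → x ≐ y → SameForm B x y
    ≐⇒SameForm e = (λ z → sumFin-cong n (λ l → *-congˡ (+-cong (*-congʳ (e (α l))) (-‿cong (*-congʳ (e (β l)))))))
                 , (λ z → sumFin-cong n (λ l → *-congˡ (+-cong (*-congˡ (e (β l))) (-‿cong (*-congˡ (e (α l)))))))

    evaluationForm-pfaffian-cong : ∀ m {r s} → Pointwise _≐_ r s → pfaffian B m r ≈ pfaffian B m s
    evaluationForm-pfaffian-cong m rs = multilinear-cong B (pfaffian-multilinear B m) (Pointwise.map ≐⇒SameForm rs)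

    -- Subtracting γ times each row from the next, starting at the bottom, replaces h z^(i+1) by h z^i (z - γ).
    geometricRows-shift : ∀ m γ (h k : Fun) (G : Vec Fun (suc m) → Carrier) → AlternatingMultilinear B G →
      (∀ z → k z ≈ h z * (z - γ)) → G (geometricRows h (suc m)) ≈ G (h ∷ geometricRows k m)
    geometricRows-shift zero γ h k G hG e = refl
    geometricRows-shift (suc m) γ h k G hG e = begin
      G (h ∷ geometricRows hz (suc m))
        ≈⟨ geometricRows-shift m γ hz kz (λ Y → G (h ∷ Y)) (alternatingMultilinear-∷ B hG h) (λ z →
             trans (*-congʳ (e z)) (solve 3 (λ a b c → (a :* (b :- c)) :* b := (a :* b) :* (b :- c)) refl (h z) z γ)) ⟩
      G (h ∷ hz ∷ geometricRows kz m)
        ≈⟨ sym (alternatingMultilinear-addAdjacent B hG (- γ) h (geometricRows kz m)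
                  (evaluationForm-affineˡ (- γ) k hz h k≈hz-γh) (evaluationForm-affineʳ (- γ) k hz h k≈hz-γh)) ⟩
      G (h ∷ k ∷ geometricRows kz m) ∎
      where
      hz kz : Fun
      hz z = h z * z
      kz z = k z * z
      k≈hz-γh : ∀ z → k z ≈ hz z + (- γ) * h z
      k≈hz-γh z = trans (e z) (solve 3 (λ a b c → a :* (b :- c) := a :* b :+ (:- c) :* a) refl (h z) z γ)

    geometricRows-shift₂ : ∀ d γ₁ γ₂ →
      pfaffian B (suc (suc d)) (geometricRows one (suc (suc d))) ≈
        pfaffian B (suc (suc d)) (one ∷ (λ z → z - γ₁) ∷ geometricRows (λ z → (z - γ₁) * (z - γ₂)) d)
    geometricRows-shift₂ d γ₁ γ₂ = trans
      (geometricRows-shift (suc d) γ₁ one (λ z → z - γ₁) (pfaffian B (suc (suc d))) pf-am (λ z → sym (*-identityˡ _)))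
      (geometricRows-shift d γ₂ (λ z → z - γ₁) (λ z → (z - γ₁) * (z - γ₂)) (λ Y → pfaffian B (suc (suc d)) (one ∷ Y))
                           (alternatingMultilinear-∷ B pf-am one) (λ z → refl))
      where pf-am = pfaffian-alternatingMultilinear B evaluationForm-alternating (suc (suc d))

  geometricRows-scale : ∀ d (h k f : Fun) → (∀ z → h z ≈ f z * k z) →
    Pointwise _≐_ (geometricRows h d) (map (λ r z → f z * r z) (geometricRows k d))
  geometricRows-scale zero h k f e = []
  geometricRows-scale (suc d) h k f e = e ∷ geometricRows-scale d (λ z → h z * z) (λ z → k z * z) f
    (λ z → trans (*-congʳ (e z)) (*-assoc _ _ _))

  reweight : ∀ {n} (α β w : Fin n → Carrier) → Fun → Fin n → Carrier
  reweight α β w p l = w l * (p (α l) * p (β l))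

  pfaffian-geometricRows-reweight : ∀ n (α β w : Fin n → Carrier) p d →
    pfaffian (evaluationForm n α β w) d (geometricRows p d) ≈
      pfaffian (evaluationForm n α β (reweight α β w p)) d (geometricRows one d)
  pfaffian-geometricRows-reweight n α β w p d = begin
    pfaffian B d (geometricRows p d)
      ≈⟨ evaluationForm-pfaffian-cong n α β w d (geometricRows-scale d p one p (λ z → sym (*-identityʳ _))) ⟩
    pfaffian B d (map P (geometricRows one d))
      ≈⟨ pfaffian-map B P d (geometricRows one d) ⟩
    pfaffian (λ x z → B (P x) (P z)) d (geometricRows one d)
      ≈⟨ pfaffian-cong (λ x z → sumFin-cong n (λ l →
           solve 7 (λ k p q a b u v → k :* ((p :* a) :* (q :* v) :- (q :* b) :* (p :* u))
                                        := (k :* (p :* q)) :* (a :* v :- b :* u))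
                 refl (w l) (p (α l)) (p (β l)) (x (α l)) (x (β l)) (z (α l)) (z (β l)))) d (geometricRows one d) ⟩
    pfaffian (evaluationForm n α β (reweight α β w p)) d (geometricRows one d) ∎
    where
    B = evaluationForm n α β w
    P : Fun → Fun
    P r z = p z * r z

  double : ℕ → ℕ
  double zero = zero
  double (suc N) = suc (suc (double N))

  momentPfaffian : (n : ℕ) (α β w : Fin n → Carrier) → ℕ → Carrier
  momentPfaffian n α β w N = pfaffian (evaluationForm n α β w) (double N) (geometricRows one (double N))

  vanishingAt : Carrier → Carrier → Fun
  vanishingAt a b z = (z - a) * (z - b)

  momentPfaffian-suc : ∀ n (α β w : Fin (suc n) → Carrier) N →
    momentPfaffian (suc n) α β w (suc N) ≈
      (head w * (head β - head α))
        * momentPfaffian n (tail α) (tail β) (reweight (tail α) (tail β) (tail w) (vanishingAt (head β) (head α))) N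
      + momentPfaffian n (tail α) (tail β) (tail w) (suc N)
  momentPfaffian-suc n α β w N = begin
    pfaffian B (suc (suc d)) (geometricRows one (suc (suc d)))
      ≈⟨ geometricRows-shift₂ (suc n) α β w d β₀ α₀ ⟩
    pfaffian B (suc (suc d)) (one ∷ h₁ ∷ geometricRows h₂ d)
      ≈⟨ pfaffian-split d one h₁ (geometricRows h₂ d) (geometricRows-radical d h₂ h₂-α₀ h₂-β₀) ⟩
    g₁ one h₁ * pfaffian B′ d (geometricRows h₂ d) + pfaffian B′ (suc (suc d)) (one ∷ h₁ ∷ geometricRows h₂ d)
      ≈⟨ +-cong (*-cong g₁-one-h₁ (pfaffian-geometricRows-reweight n (tail α) (tail β) (tail w) h₂ d))
                (sym (geometricRows-shift₂ n (tail α) (tail β) (tail w) d β₀ α₀)) ⟩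
    (head w * (β₀ - α₀)) * momentPfaffian n (tail α) (tail β) (reweight (tail α) (tail β) (tail w) h₂) N
      + momentPfaffian n (tail α) (tail β) (tail w) (suc N) ∎
    where
    d = double N
    α₀ = head α
    β₀ = head β
    h₁ : Fun
    h₁ z = z - β₀
    h₂ : Fun
    h₂ = vanishingAt β₀ α₀
    B = evaluationForm (suc n) α β w
    B′ = evaluationForm n (tail α) (tail β) (tail w)
    g₁ : Fun → Fun → Carrier
    g₁ u v = head w * (u α₀ * v β₀ - u β₀ * v α₀)
    open Splitting B g₁ B′ (λ x z → refl)

    geometricRows-radical : ∀ d h → h α₀ ≈ 0# → h β₀ ≈ 0# → All RightRadical (geometricRows h d)
    geometricRows-radical zero h _ _ = []
    geometricRows-radical (suc d) h hα hβ =
      (λ u → trans (*-congˡ (+-cong (*-congˡ hβ) (-‿cong (*-congˡ hα))))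
                   (solve 3 (λ k a b → k :* (a :* con (+ 0) :- b :* con (+ 0)) := con (+ 0)) refl (head w) (u α₀) (u β₀)))
      ∷ geometricRows-radical d (λ z → h z * z) (trans (*-congʳ hα) (zeroˡ _)) (trans (*-congʳ hβ) (zeroˡ _))

    h₂-α₀ : h₂ α₀ ≈ 0#
    h₂-α₀ = trans (*-congˡ (-‿inverseʳ α₀)) (zeroʳ _)
    h₂-β₀ : h₂ β₀ ≈ 0#
    h₂-β₀ = trans (*-congʳ (-‿inverseʳ β₀)) (zeroˡ _)

    g₁-one-h₁ : g₁ one h₁ ≈ head w * (β₀ - α₀)
    g₁-one-h₁ = trans (*-congˡ (+-cong (*-identityˡ _) (-‿cong (*-identityˡ _))))
      (solve 3 (λ k a b → k :* ((b :- b) :- (a :- b)) := k :* (b :- a)) refl (head w) α₀ β₀)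

  momentPfaffian-vanishes : ∀ n (α β w : Fin n → Carrier) N → n ℕ.< N → momentPfaffian n α β w N ≈ 0#
  momentPfaffian-vanishes zero α β w (suc N) _ =
    sumFin-zero (suc (double N)) (λ p → alt-zero (toℕ p) (zeroˡ (pfaffian B (double N) (removeAt rows p))))
    where
    B = evaluationForm zero α β w
    rows = geometricRows (λ z → one z * z) (suc (double N))
  momentPfaffian-vanishes (suc n) α β w (suc N) (ℕ.s≤s n<N) = begin
    momentPfaffian (suc n) α β w (suc N)
      ≈⟨ momentPfaffian-suc n α β w N ⟩
    _ * momentPfaffian n (tail α) (tail β) _ N + momentPfaffian n (tail α) (tail β) (tail w) (suc N)
      ≈⟨ +-cong (trans (*-congˡ (momentPfaffian-vanishes n _ _ _ N n<N)) (zeroʳ _))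
                (momentPfaffian-vanishes n _ _ _ (suc N) (ℕ.m<n⇒m<1+n n<N)) ⟩
    0# + 0#
      ≈⟨ +-identityʳ _ ⟩
    0# ∎

  crossFactor : ∀ {n} (α β : Fin n → Carrier) → Fin n → Fin n → Carrier
  crossFactor α β l m = vanishingAt (β l) (α l) (α m) * vanishingAt (β l) (α l) (β m)

  momentPfaffian-diagonal : ∀ n (α β w : Fin n → Carrier) →
    momentPfaffian n α β w n ≈ prodFin R n (λ l → w l * (β l - α l)) * prodPairs R n (crossFactor α β)
  momentPfaffian-diagonal zero α β w = sym (*-identityˡ _)
  momentPfaffian-diagonal (suc n) α β w = begin
    momentPfaffian (suc n) α β w (suc n)
      ≈⟨ momentPfaffian-suc n α β w n ⟩
    X * momentPfaffian n (tail α) (tail β) w″ n + momentPfaffian n (tail α) (tail β) (tail w) (suc n)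
      ≈⟨ +-cong (*-congˡ (momentPfaffian-diagonal n (tail α) (tail β) w″))
                (momentPfaffian-vanishes n (tail α) (tail β) (tail w) (suc n) (ℕ.n<1+n n)) ⟩
    X * (prodFin R n (λ l → w″ l * (tail β l - tail α l)) * S) + 0#
      ≈⟨ +-congʳ (*-congˡ (*-congʳ (trans (prodFin-cong n (λ l →
           solve 3 (λ a e d → (a :* e) :* d := (a :* d) :* e) refl (tail w l) (Q′ l) (tail β l - tail α l)))
           (prodFin-* n (λ l → tail w l * (tail β l - tail α l)) Q′)))) ⟩
    X * ((P * Q) * S) + 0#
      ≈⟨ solve 4 (λ X P Q S → X :* ((P :* Q) :* S) :+ con (+ 0) := (X :* P) :* (Q :* S)) refl X P Q S ⟩
    (X * P) * (Q * S)
      ≈⟨ *-congˡ (sym (prodPairs-suc n (crossFactor α β))) ⟩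
    prodFin R (suc n) (λ l → w l * (β l - α l)) * prodPairs R (suc n) (crossFactor α β) ∎
    where
    w″ = reweight (tail α) (tail β) (tail w) (vanishingAt (head β) (head α))
    Q′ : Fin n → Carrier
    Q′ l = crossFactor α β Fin.zero (Fin.suc l)
    X = head w * (head β - head α)
    P = prodFin R n (λ l → tail w l * (tail β l - tail α l))
    Q = prodFin R n Q′
    S = prodPairs R n (crossFactor (tail α) (tail β))

module Specialisation {c ℓ : Level} (R : CommutativeRing c ℓ) where
  open import Data.Nat.Combinatorics using (nC1≡n; nCk+nC[k+1]≡[n+1]C[k+1])
  open CommutativeRing R hiding (zero)
  open IntegerCoefficientSolver R
  open RingLemmas R
  open GeneralPfaffian R
  open MomentPfaffian R
  open import Relation.Binary.Reasoning.Setoid setoid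

  pfAux≈pfaffian : ∀ (a : ℕ → ℕ → Carrier) m v → pfAux R a m v ≈ pfaffian a m v
  pfAux≈pfaffian a zero [] = refl
  pfAux≈pfaffian a (suc zero) _ = refl
  pfAux≈pfaffian a (suc (suc m)) (i ∷ r) = sumFin-cong (suc m) (λ p → alt-cong (toℕ p)
    (*-congˡ {a i (lookup r p)} (pfAux≈pfaffian a m (removeAt r p))))

  double≡2* : ∀ n → double n ≡ 2 ℕ.* n
  double≡2* zero = ≡.refl
  double≡2* (suc n) = ≡.trans (≡.cong (λ t → suc (suc t)) (double≡2* n)) (≡.sym (ℕ.*-suc 2 n))

  geometricRows-tabulate : ∀ m (h : Fun) (f : Fin m → Fun) → (∀ i z → f i z ≈ h z * pow R z (toℕ i)) →
                           Pointwise _≐_ (geometricRows h m) (tabulate f)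
  geometricRows-tabulate zero h f e = []
  geometricRows-tabulate (suc m) h f e = (λ z → sym (trans (e Fin.zero z) (*-identityʳ _)))
    ∷ geometricRows-tabulate m (λ z → h z * z) (λ i → f (Fin.suc i))
        (λ i z → trans (e (Fin.suc i) z) (solve 3 (λ a b c → a :* (b :* c) := (a :* b) :* c) refl (h z) z (pow R z (toℕ i))))

  matrixExponent : ∀ i j k → ((+ (suc i ℕ.+ suc j)) ℤ.- + 3) ℤ.+ k ≡ (k ℤ.+ -[1+ 0 ]) ℤ.+ + (i ℕ.+ j)
  matrixExponent i j k = ≡.trans (≡.cong (ℤ._+ k) shift)
    (≡.trans (ℤ.+-assoc (+ (i ℕ.+ j)) -[1+ 0 ] k)
    (≡.trans (≡.cong (λ t → (+ (i ℕ.+ j)) ℤ.+ t) (ℤ.+-comm -[1+ 0 ] k))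
    (ℤ.+-comm (+ (i ℕ.+ j)) (k ℤ.+ -[1+ 0 ]))))
    where
    shift : (+ (suc i ℕ.+ suc j)) ℤ.- + 3 ≡ + (i ℕ.+ j) ℤ.+ -[1+ 0 ]
    shift = ≡.trans (ℤ.[1+m]⊖[1+n]≡m⊖n (i ℕ.+ suc j) 2)
      (≡.trans (≡.cong (ℤ._⊖ 2) (ℕ.+-suc i j)) (ℤ.[1+m]⊖[1+n]≡m⊖n (i ℕ.+ j) 1))

  module _ (n : ℕ) (x y : Fin n → Carrier) (q : Carrier) (k : ℤ) (xy≈1 : ∀ i → x i * y i ≈ 1#) where

    qx weight : Fin n → Carrier
    qx l = q * x l
    weight l = powℤ R (x l) (y l) k * y l

    monomial : ℕ → Fun
    monomial i z = pow R z i

    -- (q^i - q^j) x^(i+j+k-1) = x^(k-1) ((q x)^i x^j - x^i (q x)^j)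
    pfMatrix≈evaluationForm : ∀ i j → pfMatrix R n x y q k (suc i) (suc j) ≈
                                      evaluationForm n qx x weight (monomial i) (monomial j)
    pfMatrix≈evaluationForm i j = trans (sym (sumFin-*ˡ n _ _)) (sumFin-cong n (λ l → begin
      (pow R q i - pow R q j) * powℤ R (x l) (y l) (((+ (suc i ℕ.+ suc j)) ℤ.- + 3) ℤ.+ k)
        ≈⟨ *-congˡ (trans (reflexive (≡.cong (powℤ R (x l) (y l)) (matrixExponent i j k)))
             (trans (powℤ-+ℕ (xy≈1 l) (k ℤ.+ -[1+ 0 ]) (i ℕ.+ j))
               (*-cong (powℤ-pred (xy≈1 l) k) (pow-+ (x l) i j)))) ⟩
      (pow R q i - pow R q j) * (weight l * (pow R (x l) i * pow R (x l) j))
        ≈⟨ solve 5 (λ Qi Qj K Xi Xj → (Qi :- Qj) :* (K :* (Xi :* Xj)) := K :* ((Qi :* Xi) :* Xj :- Xi :* (Qj :* Xj)))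
             refl (pow R q i) (pow R q j) (weight l) (pow R (x l) i) (pow R (x l) j) ⟩
      weight l * ((pow R q i * pow R (x l) i) * pow R (x l) j - pow R (x l) i * (pow R q j * pow R (x l) j))
        ≈⟨ *-congˡ (sym (+-cong (*-congʳ (pow-* q (x l) i)) (-‿cong (*-congˡ (pow-* q (x l) j))))) ⟩
      weight l * (pow R (q * x l) i * pow R (x l) j - pow R (x l) i * pow R (q * x l) j) ∎))

    PfQ≈momentPfaffian : PfQ R n x y q k ≈ momentPfaffian n qx x weight n
    PfQ≈momentPfaffian = begin
      pfAux R M (2 ℕ.* n) (tabulate (λ i → suc (toℕ i)))
        ≈⟨ pfAux≈pfaffian M (2 ℕ.* n) _ ⟩
      pfaffian M (2 ℕ.* n) (tabulate (λ i → suc (toℕ i)))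
        ≡⟨ ≡.cong (pfaffian M (2 ℕ.* n)) (tabulate-∘ suc toℕ) ⟩
      pfaffian M (2 ℕ.* n) (map suc (tabulate toℕ))
        ≈⟨ pfaffian-map M suc (2 ℕ.* n) (tabulate toℕ) ⟩
      pfaffian (λ i j → M (suc i) (suc j)) (2 ℕ.* n) (tabulate toℕ)
        ≈⟨ pfaffian-cong pfMatrix≈evaluationForm (2 ℕ.* n) (tabulate toℕ) ⟩
      pfaffian (λ i j → B (monomial i) (monomial j)) (2 ℕ.* n) (tabulate toℕ)
        ≈⟨ pfaffian-map B monomial (2 ℕ.* n) (tabulate toℕ) ⟨
      pfaffian B (2 ℕ.* n) (map monomial (tabulate toℕ))
        ≡⟨ ≡.cong (pfaffian B (2 ℕ.* n)) (tabulate-∘ monomial toℕ) ⟨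
      pfaffian B (2 ℕ.* n) (tabulate (λ i → monomial (toℕ i)))
        ≈⟨ evaluationForm-pfaffian-cong n qx x weight (2 ℕ.* n)
             (geometricRows-tabulate (2 ℕ.* n) one (λ i → monomial (toℕ i)) (λ i z → sym (*-identityˡ _))) ⟨
      pfaffian B (2 ℕ.* n) (geometricRows one (2 ℕ.* n))
        ≡⟨ ≡.cong (λ m → pfaffian B m (geometricRows one m)) (double≡2* n) ⟨
      momentPfaffian n qx x weight n ∎
      where
      M = pfMatrix R n x y q k
      B = evaluationForm n qx x weight

  suc-C-2 : ∀ n → suc n C 2 ≡ n ℕ.+ n C 2
  suc-C-2 n = ≡.trans (≡.sym (nCk+nC[k+1]≡[n+1]C[k+1] n 1)) (≡.cong (ℕ._+ (n C 2)) (nC1≡n n))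

  weight-head : ∀ x y K q → x * y ≈ 1# → (K * y) * (x - q * x) ≈ (1# - q) * K
  weight-head x y K q xy≈1 = begin
    (K * y) * (x - q * x)  ≈⟨ solve 4 (λ K y x q → (K :* y) :* (x :- q :* x) := (x :* y) :* (K :- q :* K)) refl K y x q ⟩
    (x * y) * (K - q * K)  ≈⟨ trans (*-congʳ xy≈1) (*-identityˡ _) ⟩
    K - q * K              ≈⟨ +-congʳ (sym (*-identityˡ K)) ⟩
    1# * K - q * K         ≈⟨ solve 3 (λ o q K → o :* K :- q :* K := (o :- q) :* K) refl 1# q K ⟩
    (1# - q) * K           ∎

  crossFactor-head : ∀ {n} q (x : Fin (suc n) → Carrier) m → let a = head x; b = x (Fin.suc m) in
    crossFactor (λ l → q * x l) x Fin.zero (Fin.suc m) ≈ (- q) * (((a - b) * (a - b)) * ((a - q * b) * (b - q * a)))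
  crossFactor-head q x m =
    solve 3 (λ q a b → ((q :* b :- a) :* (q :* b :- q :* a)) :* ((b :- a) :* (b :- q :* a))
                       := (:- q) :* (((a :- b) :* (a :- b)) :* ((a :- q :* b) :* (b :- q :* a)))) refl q (head x) (x (Fin.suc m))

  prodFin-crossFactor-head : ∀ n q (x : Fin (suc n) → Carrier) →
    prodFin R n (λ m → crossFactor (λ l → q * x l) x Fin.zero (Fin.suc m)) ≈
      pow R (- q) n * ((prodFin R n (λ m → head x - tail x m) * prodFin R n (λ m → head x - tail x m))
                       * prodFin R n (λ m → (head x - q * tail x m) * (tail x m - q * head x)))
  prodFin-crossFactor-head n q x = begin
    prodFin R n (λ m → crossFactor (λ l → q * x l) x Fin.zero (Fin.suc m))
      ≈⟨ prodFin-cong n (crossFactor-head q x) ⟩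
    prodFin R n (λ m → (- q) * (D m * D m * E m))
      ≈⟨ prodFin-* n (λ _ → - q) _ ⟩
    prodFin R n (λ _ → - q) * prodFin R n (λ m → D m * D m * E m)
      ≈⟨ *-cong (prodFin-const n (- q)) (trans (prodFin-* n _ E) (*-congʳ (prodFin-* n D D))) ⟩
    pow R (- q) n * ((prodFin R n D * prodFin R n D) * prodFin R n E) ∎
    where
    D E : Fin n → Carrier
    D m = head x - tail x m
    E m = (head x - q * tail x m) * (tail x m - q * head x)

  productFormula : ∀ n (x y : Fin n → Carrier) q k → (∀ i → x i * y i ≈ 1#) →
    prodFin R n (λ l → (powℤ R (x l) (y l) k * y l) * (x l - q * x l)) * prodPairs R n (crossFactor (λ l → q * x l) x)
      ≈ pow R (- q) (n C 2) * pow R (1# - q) n * prodFin R n (λ i → powℤ R (x i) (y i) k)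
          * (vandermonde R n x * vandermonde R n x) * Dq R n x q
  productFormula zero x y q k _ =
    trans (*-identityʳ _) (sym (trans (*-identityʳ _) (trans (*-cong (trans (*-identityʳ _) 1·1) 1·1) 1·1)))
    where 1·1 = *-identityʳ 1#
  productFormula (suc n) x y q k xy≈1 = begin
    (F₀ * F′) * prodPairs R (suc n) (crossFactor (λ l → q * x l) x)
      ≈⟨ *-congˡ (prodPairs-suc n (crossFactor (λ l → q * x l) x)) ⟩
    (F₀ * F′) * (C₀ * C′)
      ≈⟨ solve 4 (λ a b c d → (a :* b) :* (c :* d) := (a :* c) :* (b :* d)) refl F₀ F′ C₀ C′ ⟩
    (F₀ * C₀) * (F′ * C′)
      ≈⟨ *-cong (*-cong (weight-head x₀ (head y) K₀ q (xy≈1 Fin.zero)) (prodFin-crossFactor-head n q x))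
                (productFormula n (tail x) (tail y) q k (λ i → xy≈1 (Fin.suc i))) ⟩
    ((W * K₀) * (N * ((P₁ * P₁) * P₂))) * ((((A * Wⁿ) * K′) * (V′ * V′)) * D′)
      ≈⟨ solve 10 (λ W K₀ N P₁ P₂ A Wⁿ K′ V′ D′ →
            ((W :* K₀) :* (N :* ((P₁ :* P₁) :* P₂))) :* ((((A :* Wⁿ) :* K′) :* (V′ :* V′)) :* D′)
            := ((((N :* A) :* (W :* Wⁿ)) :* (K₀ :* K′)) :* ((P₁ :* V′) :* (P₁ :* V′))) :* (P₂ :* D′))
           refl W K₀ N P₁ P₂ A Wⁿ K′ V′ D′ ⟩
    ((((N * A) * (W * Wⁿ)) * (K₀ * K′)) * ((P₁ * V′) * (P₁ * V′))) * (P₂ * D′)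
      ≈⟨ sym (*-cong (*-cong (*-congʳ (*-congʳ (trans (reflexive (≡.cong (pow R (- q)) (suc-C-2 n))) (pow-+ (- q) n (n C 2)))))
                             (*-cong (prodPairs-suc n (λ i j → x i - x j)) (prodPairs-suc n (λ i j → x i - x j))))
                     (prodPairs-suc n (λ i j → (x i - q * x j) * (x j - q * x i)))) ⟩
    pow R (- q) (suc n C 2) * pow R (1# - q) (suc n) * prodFin R (suc n) (λ i → powℤ R (x i) (y i) k)
      * (vandermonde R (suc n) x * vandermonde R (suc n) x) * Dq R (suc n) x q ∎
    where
    x₀ = head x
    K₀ = powℤ R x₀ (head y) k
    F₀ = (K₀ * head y) * (x₀ - q * x₀)
    F′ = prodFin R n (λ l → (powℤ R (tail x l) (tail y l) k * tail y l) * (tail x l - q * tail x l))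
    C₀ = prodFin R n (λ m → crossFactor (λ l → q * x l) x Fin.zero (Fin.suc m))
    C′ = prodPairs R n (crossFactor (λ l → q * tail x l) (tail x))
    W = 1# - q
    N = pow R (- q) n
    P₁ = prodFin R n (λ m → x₀ - tail x m)
    P₂ = prodFin R n (λ m → (x₀ - q * tail x m) * (tail x m - q * x₀))
    A = pow R (- q) (n C 2)
    Wⁿ = pow R (1# - q) n
    K′ = prodFin R n (λ i → powℤ R (tail x i) (tail y i) k)
    V′ = vandermonde R n (tail x)
    D′ = Dq R n (tail x) q

mainTheorem3 : {c ℓ : Level} (R : CommutativeRing c ℓ) (n : ℕ)
    (x y : Fin n → CommutativeRing.Carrier R) (q : CommutativeRing.Carrier R) (k : ℤ) →
    (∀ i → CommutativeRing._≈_ R (CommutativeRing._*_ R (x i) (y i)) (CommutativeRing.1# R)) →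
    let open CommutativeRing R in
    PfQ R n x y q k ≈
      pow R (- q) (n C 2) * pow R (1# - q) n
        * prodFin R n (λ i → powℤ R (x i) (y i) k)
        * (vandermonde R n x * vandermonde R n x)
        * Dq R n x q
mainTheorem3 R n x y q k xy≈1 = begin
  PfQ R n x y q k
    ≈⟨ PfQ≈momentPfaffian n x y q k xy≈1 ⟩
  momentPfaffian n (λ l → q * x l) x (weight n x y q k xy≈1) n
    ≈⟨ momentPfaffian-diagonal n (λ l → q * x l) x (weight n x y q k xy≈1) ⟩
  prodFin R n (λ l → weight n x y q k xy≈1 l * (x l - q * x l)) * prodPairs R n (crossFactor (λ l → q * x l) x)
    ≈⟨ productFormula n x y q k xy≈1 ⟩
  pow R (- q) (n C 2) * pow R (1# - q) n * prodFin R n (λ i → powℤ R (x i) (y i) k)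
    * (vandermonde R n x * vandermonde R n x) * Dq R n x q ∎
  where
  open CommutativeRing R
  open MomentPfaffian R
  open Specialisation R
  open import Relation.Binary.Reasoning.Setoid setoid
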